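{- Let $\mathcal{R}=\{\beta,\mu,\rho,\theta,\varepsilon\}$. Let $M\in\mathcal{SN}_{\mathcal{R}}\cap\mathcal{T}_t$ and let $\alpha$ be a $\mu$-variable such that $[\alpha]M\in\mathcal{T}_t$. Then $[\alpha]M\in\mathcal{SN}_{\mathcal{R}}\cap\mathcal{T}_t$.
   Context: $\lambda\mu$-terms: $\mathcal{T} ::= x \mid \lambda x.\mathcal{T} \mid (\mathcal{T})\mathcal{T} \mid [\alpha]\mathcal{T} \mid \mu\alpha.\mathcal{T}$, up to renaming of bound variables; substitutions avoid capture. Types $A ::= X \mid \bot \mid A\to B$; typing judgments $\Gamma\vdash M:A;\Theta$ by: $\Gamma,x:A\vdash x:A;\Theta$; from $\Gamma,x:A\vdash M:B;\Theta$ infer $\Gamma\vdash\lambda x.M:A\to B;\Theta$; from $\Gamma\vdash M:A\to B;\Theta$, $\Gamma\vdash N:A;\Theta$ infer $\Gamma\vdash(M)N:B;\Theta$; from $\Gamma\vdash M:A;\alpha:A,\Theta$ infer $\Gamma\vdash[\alpha]M:\bot;\alpha:A,\Theta$; from $\Gamma\vdash M:\bot;\alpha:A,\Theta$ infer $\Gamma\vdash\mu\alpha.M:A;\Theta$. $\mathcal{T}_t$ = typable terms. $M[\alpha:=\beta]$ renaming; $M[\alpha:=_rN]$ replaces inductively each $[\alpha]P$ by $[\alpha](P')N$; $M_\alpha$ replaces inductively each $[\alpha]P$ by $P$. Rules: $\beta$: $(\lambda x.M)N\to M[x:=N]$; $\mu$: $(\mu\alpha.M)N\to\mu\alpha.M[\alpha:=_rN]$;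 $\rho$: $[\beta]\mu\alpha.M\to M[\alpha:=\beta]$; $\theta$: $\mu\alpha.[\alpha]M\to M$ if $\alpha\notin\mathrm{fv}(M)$; $\varepsilon$: $\mu\alpha.\mu\beta.M\to\mu\alpha.M_\beta$. One-step reduction contracts one redex anywhere; $\mathcal{SN}_{\mathcal{R}}$ = terms with no infinite $\mathcal{R}$-reduction sequence. -}

module Defs where

open import Data.Nat using (ℕ; zero; suc; pred; _≡ᵇ_)
open import Data.Bool using (if_then_else_)
open import Data.Product using (Σ; ∃; _×_; _,_)
open import Induction.WellFounded using (Acc)

-- λμ-terms, de Bruijn style (two separate index spaces:
-- λ-variables and μ-variables). Terms are thus taken up to α-renaming.
--   var x     : x
--   lam M     : λx.M       (binds λ-index 0 in M)
--   app M N   : (M)N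
--   name a M  : [α]M       (a = μ-index of α)
--   mu M      : μα.M       (binds μ-index 0 in M)

data Term : Set where
  var  : ℕ → Term
  lam  : Term → Term
  app  : Term → Term → Term
  name : ℕ → Term → Term
  mu   : Term → Term

ext : (ℕ → ℕ) → ℕ → ℕ
ext ρ zero    = zero
ext ρ (suc n) = suc (ρ n)

trename : (ℕ → ℕ) → Term → Term
trename ρ (var x)    = var (ρ x)
trename ρ (lam M)    = lam (trename (ext ρ) M)
trename ρ (app M N)  = app (trename ρ M) (trename ρ N)
trename ρ (name a M) = name a (trename ρ M)
trename ρ (mu M)     = mu (trename ρ M)

mrename : (ℕ → ℕ) → Term → Term
mrename σ (var x)    = var x
mrename σ (lam M)    = lam (mrename σ M)
mrename σ (app M N)  = app (mrename σ M) (mrename σ N)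
mrename σ (name a M) = name (σ a) (mrename σ M)
mrename σ (mu M)     = mu (mrename (ext σ) M)

exts : (ℕ → Term) → ℕ → Term
exts σ zero    = var zero
exts σ (suc n) = trename suc (σ n)

tsubst : (ℕ → Term) → Term → Term
tsubst σ (var x)    = σ x
tsubst σ (lam M)    = lam (tsubst (exts σ) M)
tsubst σ (app M N)  = app (tsubst σ M) (tsubst σ N)
tsubst σ (name a M) = name a (tsubst σ M)
tsubst σ (mu M)     = mu (tsubst (λ n → mrename suc (σ n)) M)

_•_ : {A : Set} → A → (ℕ → A) → ℕ → A
(a • f) zero    = a
(a • f) (suc n) = f n

_[0:=_] : Term → Term → Term
M [0:= N ] = tsubst (N • var) M

rsubst : ℕ → Term → Term → Term
rsubst α N (var x)    = var x
rsubst α N (lam M)    = lam (rsubst α (trename suc N) M)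
rsubst α N (app M P)  = app (rsubst α N M) (rsubst α N P)
rsubst α N (name a P) =
  if a ≡ᵇ α then name a (app (rsubst α N P) N) else name a (rsubst α N P)
rsubst α N (mu M)     = mu (rsubst (suc α) (mrename suc N) M)

unname : ℕ → Term → Term
unname α (var x)    = var x
unname α (lam M)    = lam (unname α M)
unname α (app M N)  = app (unname α M) (unname α N)
unname α (name a P) = if a ≡ᵇ α then unname α P else name a (unname α P)
unname α (mu M)     = mu (unname (suc α) M)

infix 4 _⟶_
data _⟶_ : Term → Term → Set where
  β-red : ∀ {M N} → app (lam M) N ⟶ M [0:= N ]
  μ-red : ∀ {M N} → app (mu M) N ⟶ mu (rsubst zero (mrename suc N) M)
  ρ-red : ∀ {b M} → name b (mu M) ⟶ mrename (b • (λ n → n)) M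
  -- μα.[α]M → M, α ∉ fv(M)  (freshness: M is a μ-shift of M')
  θ-red : ∀ {M} → mu (name zero (mrename suc M)) ⟶ M
  ε-red : ∀ {M} → mu (mu M) ⟶ mu (mrename pred (unname zero M))
  ξ-lam  : ∀ {M M'} → M ⟶ M' → lam M ⟶ lam M'
  ξ-appˡ : ∀ {M M' N} → M ⟶ M' → app M N ⟶ app M' N
  ξ-appʳ : ∀ {M N N'} → N ⟶ N' → app M N ⟶ app M N'
  ξ-name : ∀ {a M M'} → M ⟶ M' → name a M ⟶ name a M'
  ξ-mu   : ∀ {M M'} → M ⟶ M' → mu M ⟶ mu M'

SN : Term → Set
SN = Acc (λ N M → M ⟶ N)

data Ty : Set where
  atom : ℕ → Ty
  ⊥ty  : Ty
  _⇒_  : Ty → Ty → Ty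

Ctx : Set
Ctx = ℕ → Ty

infix 3 _⊢_∶_∣_
data _⊢_∶_∣_ : Ctx → Term → Ty → Ctx → Set where
  ty-var  : ∀ {Γ Θ x} → Γ ⊢ var x ∶ Γ x ∣ Θ
  ty-lam  : ∀ {Γ Θ A B M} → (A • Γ) ⊢ M ∶ B ∣ Θ → Γ ⊢ lam M ∶ A ⇒ B ∣ Θ
  ty-app  : ∀ {Γ Θ A B M N} → Γ ⊢ M ∶ A ⇒ B ∣ Θ → Γ ⊢ N ∶ A ∣ Θ
          → Γ ⊢ app M N ∶ B ∣ Θ
  ty-name : ∀ {Γ Θ a M} → Γ ⊢ M ∶ Θ a ∣ Θ → Γ ⊢ name a M ∶ ⊥ty ∣ Θ
  ty-mu   : ∀ {Γ Θ A M} → Γ ⊢ M ∶ ⊥ty ∣ (A • Θ) → Γ ⊢ mu M ∶ A ∣ Θ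

Typable : Term → Set
Typable M = Σ Ctx λ Γ → Σ Ctx λ Θ → Σ Ty λ A → Γ ⊢ M ∶ A ∣ Θ

module Submission where

open import Defs
open import Data.Bool using (true; false; T)
open import Data.Bool.Properties using (T-≡; ⇔→≡)
open import Data.Empty using (⊥-elim)
open import Data.Nat using (ℕ; zero; suc; pred; _≡ᵇ_)
open import Data.Nat.Properties using (≡ᵇ⇒≡; ≡⇒≡ᵇ)
open import Data.Product using (_×_; _,_; ∃-syntax)
open import Function using (_∘_; id; Equivalence; mk⇔)
open import Induction.WellFounded using (acc)
open import Relation.Binary.PropositionalEquality
open import Relation.Nullary using (¬_)

-- A step from [α]M either reduces inside M, or is the ρ-step
-- [α]μβ.M' → M'[β:=α].  So it suffices that μ-renaming preserves SN, which
-- holds because every step of a renamed term M σ is the image of a step of M.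
-- The only delicate case is θ, whose side condition β ∉ fv(M) must be
-- reflected back through a possibly non-injective σ.

mrename-cong : ∀ {f g} → (∀ a → f a ≡ g a) → ∀ M → mrename f M ≡ mrename g M
mrename-cong h (var x)    = refl
mrename-cong h (lam M)    = cong lam (mrename-cong h M)
mrename-cong h (app M N)  = cong₂ app (mrename-cong h M) (mrename-cong h N)
mrename-cong h (name a M) = cong₂ name (h a) (mrename-cong h M)
mrename-cong h (mu M)     = cong mu (mrename-cong h′ M)
  where
  h′ : ∀ a → ext _ a ≡ ext _ a
  h′ zero    = refl
  h′ (suc a) = cong suc (h a)

mrename-id : ∀ M → mrename id M ≡ M
mrename-id (var x)    = refl
mrename-id (lam M)    = cong lam (mrename-id M)
mrename-id (app M N)  = cong₂ app (mrename-id M) (mrename-id N)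
mrename-id (name a M) = cong (name a) (mrename-id M)
mrename-id (mu M)     =
  cong mu (trans (mrename-cong (λ { zero → refl ; (suc a) → refl }) M) (mrename-id M))

mrename-∘ : ∀ f g M → mrename f (mrename g M) ≡ mrename (f ∘ g) M
mrename-∘ f g (var x)    = refl
mrename-∘ f g (lam M)    = cong lam (mrename-∘ f g M)
mrename-∘ f g (app M N)  = cong₂ app (mrename-∘ f g M) (mrename-∘ f g N)
mrename-∘ f g (name a M) = cong (name (f (g a))) (mrename-∘ f g M)
mrename-∘ f g (mu M)     = cong mu (trans (mrename-∘ (ext f) (ext g) M)
  (mrename-cong (λ { zero → refl ; (suc a) → refl }) M))

mrename-ext-suc : ∀ σ M → mrename (ext σ) (mrename suc M) ≡ mrename suc (mrename σ M)
mrename-ext-suc σ M = trans (mrename-∘ (ext σ) suc M) (sym (mrename-∘ suc σ M))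

mrename-trename : ∀ σ ρ M → mrename σ (trename ρ M) ≡ trename ρ (mrename σ M)
mrename-trename σ ρ (var x)    = refl
mrename-trename σ ρ (lam M)    = cong lam (mrename-trename σ (ext ρ) M)
mrename-trename σ ρ (app M N)  = cong₂ app (mrename-trename σ ρ M) (mrename-trename σ ρ N)
mrename-trename σ ρ (name a M) = cong (name (σ a)) (mrename-trename σ ρ M)
mrename-trename σ ρ (mu M)     = cong mu (mrename-trename (ext σ) ρ M)

tsubst-cong : ∀ {τ τ′} → (∀ n → τ n ≡ τ′ n) → ∀ M → tsubst τ M ≡ tsubst τ′ M
tsubst-cong h (var x)    = h x
tsubst-cong h (lam M)    = cong lam (tsubst-cong h′ M)
  where
  h′ : ∀ n → exts _ n ≡ exts _ n
  h′ zero    = refl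
  h′ (suc n) = cong (trename suc) (h n)
tsubst-cong h (app M N)  = cong₂ app (tsubst-cong h M) (tsubst-cong h N)
tsubst-cong h (name a M) = cong (name a) (tsubst-cong h M)
tsubst-cong h (mu M)     = cong mu (tsubst-cong (cong (mrename suc) ∘ h) M)

mrename-tsubst : ∀ σ τ M →
  mrename σ (tsubst τ M) ≡ tsubst (mrename σ ∘ τ) (mrename σ M)
mrename-tsubst σ τ (var x)    = refl
mrename-tsubst σ τ (lam M)    = cong lam (trans (mrename-tsubst σ (exts τ) M)
  (tsubst-cong (λ { zero → refl ; (suc n) → mrename-trename σ suc (τ n) }) (mrename σ M)))
mrename-tsubst σ τ (app M N)  = cong₂ app (mrename-tsubst σ τ M) (mrename-tsubst σ τ N)
mrename-tsubst σ τ (name a M) = cong (name (σ a)) (mrename-tsubst σ τ M)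
mrename-tsubst σ τ (mu M)     = cong mu (trans (mrename-tsubst (ext σ) (mrename suc ∘ τ) M)
  (tsubst-cong (mrename-ext-suc σ ∘ τ) (mrename (ext σ) M)))

mrename-[0:=] : ∀ σ M N → mrename σ (M [0:= N ]) ≡ mrename σ M [0:= mrename σ N ]
mrename-[0:=] σ M N = trans (mrename-tsubst σ (N • var) M)
  (tsubst-cong (λ { zero → refl ; (suc n) → refl }) (mrename σ M))

InjectiveAt : (ℕ → ℕ) → ℕ → Set
InjectiveAt ρ α = ∀ a → ρ a ≡ ρ α → a ≡ α

ext-injectiveAt : ∀ {ρ α} → InjectiveAt ρ α → InjectiveAt (ext ρ) (suc α)
ext-injectiveAt inj zero    ()
ext-injectiveAt inj (suc a) e = cong suc (inj a (cong pred e))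

ext-injectiveAt-zero : ∀ σ → InjectiveAt (ext σ) zero
ext-injectiveAt-zero σ zero    _  = refl
ext-injectiveAt-zero σ (suc a) ()

≡ᵇ-injectiveAt : ∀ {ρ α} → InjectiveAt ρ α → ∀ a → (ρ a ≡ᵇ ρ α) ≡ (a ≡ᵇ α)
≡ᵇ-injectiveAt {ρ} {α} inj a = ⇔→≡ {z = true} (mk⇔ to from)
  where
  T⇒≡true : ∀ {b} → T b → b ≡ true
  T⇒≡true = Equivalence.to T-≡
  ≡true⇒T : ∀ {b} → b ≡ true → T b
  ≡true⇒T = Equivalence.from T-≡
  to : (ρ a ≡ᵇ ρ α) ≡ true → (a ≡ᵇ α) ≡ true
  to e = T⇒≡true (≡⇒≡ᵇ a α (inj a (≡ᵇ⇒≡ (ρ a) (ρ α) (≡true⇒T e))))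
  from : (a ≡ᵇ α) ≡ true → (ρ a ≡ᵇ ρ α) ≡ true
  from e = T⇒≡true (≡⇒≡ᵇ (ρ a) (ρ α) (cong ρ (≡ᵇ⇒≡ a α (≡true⇒T e))))

mrename-rsubst : ∀ ρ α N M → InjectiveAt ρ α →
  mrename ρ (rsubst α N M) ≡ rsubst (ρ α) (mrename ρ N) (mrename ρ M)
mrename-rsubst ρ α N (var x)    inj = refl
mrename-rsubst ρ α N (lam M)    inj = cong lam (trans (mrename-rsubst ρ α (trename suc N) M inj)
  (cong (λ N′ → rsubst (ρ α) N′ (mrename ρ M)) (mrename-trename ρ suc N)))
mrename-rsubst ρ α N (app M P)  inj =
  cong₂ app (mrename-rsubst ρ α N M inj) (mrename-rsubst ρ α N P inj)
mrename-rsubst ρ α N (name a P) inj rewrite ≡ᵇ-injectiveAt inj a with a ≡ᵇ α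
... | true  = cong (name (ρ a)) (cong₂ app (mrename-rsubst ρ α N P inj) refl)
... | false = cong (name (ρ a)) (mrename-rsubst ρ α N P inj)
mrename-rsubst ρ α N (mu M)     inj =
  cong mu (trans (mrename-rsubst (ext ρ) (suc α) (mrename suc N) M (ext-injectiveAt inj))
    (cong (λ N′ → rsubst (suc (ρ α)) N′ (mrename (ext ρ) M)) (mrename-ext-suc ρ N)))

mrename-unname : ∀ ρ α M → InjectiveAt ρ α →
  mrename ρ (unname α M) ≡ unname (ρ α) (mrename ρ M)
mrename-unname ρ α (var x)    inj = refl
mrename-unname ρ α (lam M)    inj = cong lam (mrename-unname ρ α M inj)
mrename-unname ρ α (app M P)  inj = cong₂ app (mrename-unname ρ α M inj) (mrename-unname ρ α P inj)
mrename-unname ρ α (name a P) inj rewrite ≡ᵇ-injectiveAt inj a with a ≡ᵇ α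
... | true  = mrename-unname ρ α P inj
... | false = cong (name (ρ a)) (mrename-unname ρ α P inj)
mrename-unname ρ α (mu M)     inj = cong mu (mrename-unname (ext ρ) (suc α) M (ext-injectiveAt inj))

infix 4 _∈fn_
data _∈fn_ : ℕ → Term → Set where
  here  : ∀ {a M}   → a ∈fn name a M
  name⁺ : ∀ {a b M} → a ∈fn M → a ∈fn name b M
  lam⁺  : ∀ {a M}   → a ∈fn M → a ∈fn lam M
  appˡ  : ∀ {a M N} → a ∈fn M → a ∈fn app M N
  appʳ  : ∀ {a M N} → a ∈fn N → a ∈fn app M N
  mu⁺   : ∀ {a M}   → suc a ∈fn M → a ∈fn mu M

∈fn-mrename⁺ : ∀ f {a M} → a ∈fn M → f a ∈fn mrename f M
∈fn-mrename⁺ f here      = here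
∈fn-mrename⁺ f (name⁺ p) = name⁺ (∈fn-mrename⁺ f p)
∈fn-mrename⁺ f (lam⁺ p)  = lam⁺ (∈fn-mrename⁺ f p)
∈fn-mrename⁺ f (appˡ p)  = appˡ (∈fn-mrename⁺ f p)
∈fn-mrename⁺ f (appʳ p)  = appʳ (∈fn-mrename⁺ f p)
∈fn-mrename⁺ f (mu⁺ p)   = mu⁺ (∈fn-mrename⁺ (ext f) p)

∈fn-mrename⁻ : ∀ f M {a} → a ∈fn mrename f M → ∃[ b ] f b ≡ a
∈fn-mrename⁻ f (name b M) here      = b , refl
∈fn-mrename⁻ f (name b M) (name⁺ p) = ∈fn-mrename⁻ f M p
∈fn-mrename⁻ f (lam M)    (lam⁺ p)  = ∈fn-mrename⁻ f M p
∈fn-mrename⁻ f (app M N)  (appˡ p)  = ∈fn-mrename⁻ f M p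
∈fn-mrename⁻ f (app M N)  (appʳ p)  = ∈fn-mrename⁻ f N p
∈fn-mrename⁻ f (mu M)     (mu⁺ p)   with ∈fn-mrename⁻ (ext f) M p
... | suc b , e = b , cong pred e

mrename-cong-∈fn : ∀ {f g} M → (∀ a → a ∈fn M → f a ≡ g a) → mrename f M ≡ mrename g M
mrename-cong-∈fn (var x)    h = refl
mrename-cong-∈fn (lam M)    h = cong lam (mrename-cong-∈fn M (λ a → h a ∘ lam⁺))
mrename-cong-∈fn (app M N)  h =
  cong₂ app (mrename-cong-∈fn M (λ a → h a ∘ appˡ)) (mrename-cong-∈fn N (λ a → h a ∘ appʳ))
mrename-cong-∈fn (name b M) h = cong₂ name (h b here) (mrename-cong-∈fn M (λ a → h a ∘ name⁺))
mrename-cong-∈fn (mu M)     h = cong mu (mrename-cong-∈fn M h′)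
  where
  h′ : ∀ a → a ∈fn M → ext _ a ≡ ext _ a
  h′ zero    _ = refl
  h′ (suc a) p = cong suc (h a (mu⁺ p))

zero∉fn⇒shift : ∀ M → ¬ zero ∈fn M → M ≡ mrename suc (mrename pred M)
zero∉fn⇒shift M fresh = sym (begin
  mrename suc (mrename pred M) ≡⟨ mrename-∘ suc pred M ⟩
  mrename (suc ∘ pred) M       ≡⟨ mrename-cong-∈fn M suc-pred ⟩
  mrename id M                 ≡⟨ mrename-id M ⟩
  M                            ∎)
  where
  open ≡-Reasoning
  suc-pred : ∀ a → a ∈fn M → suc (pred a) ≡ a
  suc-pred zero    p = ⊥-elim (fresh p)
  suc-pred (suc a) _ = refl

zero∉fn-shift : ∀ N → ¬ zero ∈fn mrename suc N
zero∉fn-shift N p with ∈fn-mrename⁻ suc N p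
... | _ , ()

-- This is the θ side condition pulled back along ext σ, which maps only 0 to 0.
shift-preimage : ∀ σ Y N → mrename suc N ≡ mrename (ext σ) Y →
  ∃[ Y′ ] Y ≡ mrename suc Y′ × N ≡ mrename σ Y′
shift-preimage σ Y N e = Y′ , Y≡ , N≡
  where
  open ≡-Reasoning
  Y′ : Term
  Y′ = mrename pred Y
  Y≡ : Y ≡ mrename suc Y′
  Y≡ = zero∉fn⇒shift Y
    (zero∉fn-shift N ∘ subst (zero ∈fn_) (sym e) ∘ ∈fn-mrename⁺ (ext σ))
  N≡ : N ≡ mrename σ Y′
  N≡ = begin
    N                                       ≡⟨ sym (mrename-id N) ⟩
    mrename (pred ∘ suc) N                  ≡⟨ sym (mrename-∘ pred suc N) ⟩
    mrename pred (mrename suc N)            ≡⟨ cong (mrename pred) e ⟩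
    mrename pred (mrename (ext σ) Y)        ≡⟨ cong (mrename pred ∘ mrename (ext σ)) Y≡ ⟩
    mrename pred (mrename (ext σ) (mrename suc Y′))
      ≡⟨ cong (mrename pred) (mrename-ext-suc σ Y′) ⟩
    mrename pred (mrename suc (mrename σ Y′)) ≡⟨ mrename-∘ pred suc _ ⟩
    mrename (pred ∘ suc) (mrename σ Y′)     ≡⟨ mrename-id _ ⟩
    mrename σ Y′                            ∎

mutual
  mrename-reflects-⟶ : ∀ σ M {N} → mrename σ M ⟶ N → ∃[ M′ ] M ⟶ M′ × N ≡ mrename σ M′
  mrename-reflects-⟶ σ (var x) ()
  mrename-reflects-⟶ σ (lam M) (ξ-lam s) with mrename-reflects-⟶ σ M s
  ... | M′ , s′ , refl = lam M′ , ξ-lam s′ , refl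
  mrename-reflects-⟶ σ (app (lam M) N) β-red =
    M [0:= N ] , β-red , sym (mrename-[0:=] σ M N)
  mrename-reflects-⟶ σ (app (mu M) N) μ-red =
    mu (rsubst zero (mrename suc N) M) , μ-red , cong mu (sym (begin
      mrename (ext σ) (rsubst zero (mrename suc N) M)
        ≡⟨ mrename-rsubst (ext σ) zero (mrename suc N) M (ext-injectiveAt-zero σ) ⟩
      rsubst zero (mrename (ext σ) (mrename suc N)) (mrename (ext σ) M)
        ≡⟨ cong (λ N′ → rsubst zero N′ (mrename (ext σ) M)) (mrename-ext-suc σ N) ⟩
      rsubst zero (mrename suc (mrename σ N)) (mrename (ext σ) M) ∎))
    where open ≡-Reasoning
  mrename-reflects-⟶ σ (app M N) (ξ-appˡ s) with mrename-reflects-⟶ σ M s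
  ... | M′ , s′ , refl = app M′ N , ξ-appˡ s′ , refl
  mrename-reflects-⟶ σ (app M N) (ξ-appʳ s) with mrename-reflects-⟶ σ N s
  ... | N′ , s′ , refl = app M N′ , ξ-appʳ s′ , refl
  mrename-reflects-⟶ σ (name b (mu M)) ρ-red = mrename (b • id) M , ρ-red , (begin
    mrename (σ b • id) (mrename (ext σ) M) ≡⟨ mrename-∘ (σ b • id) (ext σ) M ⟩
    mrename ((σ b • id) ∘ ext σ) M        ≡⟨ mrename-cong (λ { zero → refl ; (suc a) → refl }) M ⟩
    mrename (σ ∘ (b • id)) M              ≡⟨ sym (mrename-∘ σ (b • id) M) ⟩
    mrename σ (mrename (b • id) M)        ∎)
    where open ≡-Reasoning
  mrename-reflects-⟶ σ (name b M) (ξ-name s) with mrename-reflects-⟶ σ M s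
  ... | M′ , s′ , refl = name b M′ , ξ-name s′ , refl
  mrename-reflects-⟶ σ (mu (name k M)) s = mu-name-reflects-⟶ σ k M s refl refl
  mrename-reflects-⟶ σ (mu (mu M)) ε-red = mu (mrename pred (unname zero M)) , ε-red , cong mu (begin
    mrename pred (unname zero (mrename (ext (ext σ)) M))
      ≡⟨ cong (mrename pred) (sym (mrename-unname (ext (ext σ)) zero M (ext-injectiveAt-zero (ext σ)))) ⟩
    mrename pred (mrename (ext (ext σ)) (unname zero M))
      ≡⟨ mrename-∘ pred (ext (ext σ)) (unname zero M) ⟩
    mrename (pred ∘ ext (ext σ)) (unname zero M)
      ≡⟨ mrename-cong (λ { zero → refl ; (suc zero) → refl ; (suc (suc a)) → refl }) (unname zero M) ⟩
    mrename (ext σ ∘ pred) (unname zero M)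
      ≡⟨ sym (mrename-∘ (ext σ) pred (unname zero M)) ⟩
    mrename (ext σ) (mrename pred (unname zero M)) ∎)
    where open ≡-Reasoning
  mrename-reflects-⟶ σ (mu M) (ξ-mu s) with mrename-reflects-⟶ (ext σ) M s
  ... | M′ , s′ , refl = mu M′ , ξ-mu s′ , refl

  -- The name and body are abstracted so that matching on θ-red can unify them.
  mu-name-reflects-⟶ : ∀ σ k M {k′ M′ N} → mu (name k′ M′) ⟶ N →
    k′ ≡ ext σ k → M′ ≡ mrename (ext σ) M → ∃[ M″ ] mu (name k M) ⟶ M″ × N ≡ mrename σ M″
  mu-name-reflects-⟶ σ zero M {N = N} θ-red refl e with shift-preimage σ M N e
  ... | M′ , refl , N≡ = M′ , θ-red , N≡
  mu-name-reflects-⟶ σ (suc k) M θ-red () _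
  mu-name-reflects-⟶ σ k M (ξ-mu s) refl refl with mrename-reflects-⟶ (ext σ) (name k M) s
  ... | M′ , s′ , refl = mu M′ , ξ-mu s′ , refl

SN-mrename : ∀ σ {M} → SN M → SN (mrename σ M)
SN-mrename σ {M} (acc rs) = acc λ s → reduct-SN (mrename-reflects-⟶ σ M s)
  where
  reduct-SN : ∀ {N} → ∃[ M′ ] M ⟶ M′ × N ≡ mrename σ M′ → SN N
  reduct-SN (M′ , s , refl) = SN-mrename σ (rs s)

SN-mu⁻¹ : ∀ {M} → SN (mu M) → SN M
SN-mu⁻¹ (acc rs) = acc λ s → SN-mu⁻¹ (rs (ξ-mu s))

SN-name : ∀ α {M} → SN M → SN (name α M)
name-reduct-SN : ∀ α {M N} → SN M → name α M ⟶ N → SN N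

SN-name α sn = acc (name-reduct-SN α sn)

name-reduct-SN α (acc rs) (ξ-name s) = SN-name α (rs s)
name-reduct-SN α sn       ρ-red      = SN-mrename (α • id) (SN-mu⁻¹ sn)

lemma4p9 : (M : Term) (α : ℕ) → SN M → Typable M → Typable (name α M)
         → SN (name α M) × Typable (name α M)
lemma4p9 M α sn _ typable = SN-name α sn , typable
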